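{- For every $n\ge1$, there is a bijection between the intervals of $\mathbb{F}_n^\infty$ and the bicolored Motzkin paths of length $n-1$.
   Context: A Dyck path of semilength $n\ge 0$ is a lattice path from $(0,0)$ to $(2n,0)$ with steps $U=(1,1)$ and $D=(1,-1)$ that never goes below the $x$-axis; it is identified with its word over $\{U,D\}$. A path avoids a pattern $\alpha$ if $\alpha$ does not occur as a factor (block of consecutive steps). $\mathcal{F}_n^\infty$ is the set of Dyck paths of semilength $n$ avoiding $DUU$, ordered by the Stanley order: $P\le Q$ iff $P$ lies weakly below $Q$ when both are drawn in the plane; $\mathbb{F}_n^\infty=(\mathcal{F}_n^\infty,\le)$. An interval is a set $[P,Q]=\{R:P\le R\le Q\}$ with $P\le Q$ (equivalently, a pair $(P,Q)$ with $P\le Q$). A bicolored Motzkin path of length $m$ is a lattice path in the quarter plane $\{y\ge0\}$ starting at $(0,0)$, consisting of $m$ steps, each of which is one of $U=(1,1)$, $D=(1,-1)$, $F_1=(1,0)$, $F_2=(1,0)$ (two distinguishable kinds of flat steps); its endpoint height is arbitrary. -}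

module Defs where

open import Data.Bool using (Bool; true; false; _∧_; T)
open import Data.Nat using (ℕ; zero; suc; _*_; _≡ᵇ_; _≤ᵇ_)
open import Data.List using (List; []; _∷_; length)
open import Data.Product using (Σ; _×_; proj₁)

data Step : Set where
  U D : Step

isDyckFrom : ℕ → List Step → Bool
isDyckFrom zero    []      = true
isDyckFrom (suc _) []      = false
isDyckFrom h       (U ∷ w) = isDyckFrom (suc h) w
isDyckFrom zero    (D ∷ w) = false
isDyckFrom (suc h) (D ∷ w) = isDyckFrom h w

isDyck : List Step → Bool
isDyck = isDyckFrom 0

avoidsDUU : List Step → Bool
avoidsDUU []                  = true
avoidsDUU (D ∷ U ∷ U ∷ _)     = false
avoidsDUU (_ ∷ w)             = avoidsDUU w

-- Dyck paths of semilength n avoiding DUU (the set F_n^∞).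
-- The property is Bool-valued, hence proof-irrelevant.
F∞ : ℕ → Set
F∞ n = Σ (List Step) λ w → T (isDyck w ∧ avoidsDUU w ∧ (length w ≡ᵇ 2 * n))

-- Height after one step (heights of Dyck paths are never negative).
step : ℕ → Step → ℕ
step h       U = suc h
step zero    D = zero
step (suc h) D = h

-- Stanley order: P lies weakly below Q, i.e. at every abscissa the height
-- of P is at most the height of Q (both start at height 0).
belowFrom : ℕ → ℕ → List Step → List Step → Bool
belowFrom hp hq (p ∷ ps) (q ∷ qs) =
  (step hp p ≤ᵇ step hq q) ∧ belowFrom (step hp p) (step hq q) ps qs
belowFrom _ _ _ _ = true

_≤S_ : List Step → List Step → Bool
P ≤S Q = belowFrom 0 0 P Q

Interval : ℕ → Set
Interval n = Σ (F∞ n × F∞ n) λ PQ →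
  T (proj₁ (Data.Product.proj₁ PQ) ≤S proj₁ (Data.Product.proj₂ PQ))

data MStep : Set where
  MU MD F₁ F₂ : MStep

-- Never goes below y = 0; endpoint height arbitrary.
isMotzkinFrom : ℕ → List MStep → Bool
isMotzkinFrom _       []       = true
isMotzkinFrom h       (MU ∷ w) = isMotzkinFrom (suc h) w
isMotzkinFrom zero    (MD ∷ w) = false
isMotzkinFrom (suc h) (MD ∷ w) = isMotzkinFrom h w
isMotzkinFrom h       (F₁ ∷ w) = isMotzkinFrom h w
isMotzkinFrom h       (F₂ ∷ w) = isMotzkinFrom h w

BiMotzkin : ℕ → Set
BiMotzkin m = Σ (List MStep) λ w → T (isMotzkinFrom 0 w ∧ (length w ≡ᵇ m))

{-# OPTIONS --safe #-}
module Submission where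

-- A DUU-avoiding Dyck path of semilength m + 1 is U^(1+f) D followed by m blocks, each a "fall" D
-- or a "peak" UD, where f is the number of falls; so its (k+1)-th down step sits at position
-- 2(k+1) + (number of falls among all but the first k blocks).  The height of a Dyck path at an
-- abscissa is determined by the number of down steps after it, so P ≤ Q iff every suffix of P has
-- at most as many down steps as the suffix of Q of the same length, i.e. iff for every k the k-th
-- down step of P comes no later than that of Q.  Hence P ≤ Q iff every suffix of the block sequence
-- of P has at most as many falls as the corresponding suffix for Q.  Pairing the blocks of P and Q
-- position by position, (peak, fall) ↦ U, (fall, peak) ↦ D, (fall, fall) ↦ F₁, (peak, peak) ↦ F₂,
-- and reading the pairs from the last one, this suffix condition says exactly that the resulting
-- path of length m never goes below the axis.

open import Defs
open import Data.Bool using (Bool; T; _∧_)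
open import Data.Bool.Properties using (T-∧; T-irrelevant)
open import Data.Nat
  using (ℕ; zero; suc; _+_; _*_; _∸_; _⊓_; _≤_; _<_; _≤ᵇ_; _≡ᵇ_; _≤?_; z≤n; s≤s; s≤s⁻¹)
open import Data.Nat.Properties
open import Data.Nat.ListAction using (sum)
open import Data.Nat.ListAction.Properties using (sum-++; sum-↭)
open import Data.Nat.Tactic.RingSolver using (solve-∀)
open import Data.List
  using (List; []; _∷_; length; map; take; drop; replicate; reverse; _++_; _∷ʳ_; zipWith; unzipWith)
open import Data.List.Properties
  using ( take++drop≡id; map-++; length-++; length-replicate; length-map; length-drop; drop-all
        ; length-reverse; unfold-reverse; reverse-map; reverse-involutive; length-zipWith; zipWith-zeroʳ
        ; length-unzipWith₁; length-unzipWith₂; zipWith-unzipWith; unzipWith-zipWith )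
open import Data.List.Relation.Binary.Permutation.Propositional.Properties using (↭-reverse)
open import Data.Product using (Σ; _×_; _,_; proj₁; proj₂)
open import Data.Product.Function.NonDependent.Propositional using (_×-⇔_)
open import Function.Base using (_∘_)
open import Function.Bundles using (_⇔_; mk⇔; Equivalence; _↔_; mk↔ₛ′; _⤖_)
open import Function.Properties.Equivalence using (⇔-setoid)
  renaming (refl to ⇔-refl; trans to ⇔-trans; sym to ⇔-sym)
open import Function.Properties.Inverse using (↔⇒⤖)
open import Level using (0ℓ)
open import Relation.Binary.PropositionalEquality
open import Relation.Nullary using (yes; no)
import Relation.Binary.Reasoning.Setoid as SetoidReasoning

open Equivalence using (to; from)

module ⇔-Reasoning = SetoidReasoning (⇔-setoid 0ℓ)

count : {A : Set} → (A → ℕ) → List A → ℕ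
count f xs = sum (map f xs)

count-take+drop : {A : Set} (f : A → ℕ) (j : ℕ) (xs : List A) →
                  count f (take j xs) + count f (drop j xs) ≡ count f xs
count-take+drop f j xs = begin
  sum (map f (take j xs)) + sum (map f (drop j xs)) ≡⟨ sum-++ (map f (take j xs)) _ ⟨
  sum (map f (take j xs) ++ map f (drop j xs))      ≡⟨ cong sum (map-++ f (take j xs) _) ⟨
  sum (map f (take j xs ++ drop j xs))              ≡⟨ cong (count f) (take++drop≡id j xs) ⟩
  sum (map f xs)                                    ∎
  where open ≡-Reasoning

count-reverse : {A : Set} (f : A → ℕ) (xs : List A) → count f (reverse xs) ≡ count f xs
count-reverse f xs = trans (cong sum (reverse-map f xs)) (sum-↭ (↭-reverse (map f xs)))

∀-split : {F : ℕ → Set} → (∀ k → F k) ⇔ (F zero × ∀ k → F (suc k))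
∀-split = mk⇔ (λ f → f zero , λ k → f (suc k))
              λ { (f₀ , fₛ) zero → f₀ ; (f₀ , fₛ) (suc k) → fₛ k }

∀-cong : {A B : ℕ → Set} → (∀ k → A k ⇔ B k) → (∀ k → A k) ⇔ (∀ k → B k)
∀-cong A⇔B = mk⇔ (λ f k → to (A⇔B k) (f k)) (λ g k → from (A⇔B k) (g k))

≤-complement : ∀ {a b c d} → a + b ≡ c + d → b ≤ d ⇔ c ≤ a
≤-complement {a} {b} {c} {d} eq = mk⇔
  (λ b≤d → +-cancelʳ-≤ d c a (subst (_≤ a + d) eq (+-monoʳ-≤ a b≤d)))
  (λ c≤a → +-cancelˡ-≤ a b d (subst (_≤ a + d) (sym eq) (+-monoˡ-≤ d c≤a)))

T-≤ᵇ : ∀ {m n} → T (m ≤ᵇ n) ⇔ m ≤ n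
T-≤ᵇ {m} {n} = mk⇔ (≤ᵇ⇒≤ m n) ≤⇒≤ᵇ

suc≤suc⇔ : ∀ {m n} → suc m ≤ suc n ⇔ m ≤ n
suc≤suc⇔ = mk⇔ s≤s⁻¹ s≤s

≡-subset : {A : Set} {f : A → Bool} {a b : A} {p : T (f a)} {q : T (f b)} →
           a ≡ b → _≡_ {A = Σ A (λ x → T (f x))} (a , p) (b , q)
≡-subset refl = cong (_ ,_) (T-irrelevant _ _)

module _ {n : ℕ} {f g p q : ℕ → ℕ}
         (f-galois : ∀ {k j} → k < n → suc k ≤ f j ⇔ p k ≤ j)
         (g-galois : ∀ {k j} → k < n → suc k ≤ g j ⇔ q k ≤ j)
         (g≤n : ∀ j → g j ≤ n) where

  counts≥⇔positions≤ : (∀ j → g j ≤ f j) ⇔ (∀ k → k < n → p k ≤ q k)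
  counts≥⇔positions≤ = mk⇔ positions≤ counts≥
    where
    positions≤ : (∀ j → g j ≤ f j) → ∀ k → k < n → p k ≤ q k
    positions≤ g≤f k k<n = to (f-galois k<n) (≤-trans (from (g-galois k<n) ≤-refl) (g≤f (q k)))
    counts≥ : (∀ k → k < n → p k ≤ q k) → ∀ j → g j ≤ f j
    counts≥ p≤q j with g j in eq
    ... | zero  = z≤n
    ... | suc k = from (f-galois k<n) (≤-trans (p≤q k k<n) (to (g-galois k<n) (≤-reflexive (sym eq))))
      where
      k<n : k < n
      k<n = subst (_≤ n) eq (g≤n j)

-- Dyck words and the Stanley order

isDown : Step → ℕ
isDown U = 0
isDown D = 1

downs : List Step → ℕ
downs = count isDown

isDyckFrom-U : ∀ h w → isDyckFrom h (U ∷ w) ≡ isDyckFrom (suc h) w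
isDyckFrom-U zero    w = refl
isDyckFrom-U (suc h) w = refl

isDyckFrom-tail : ∀ h s w → T (isDyckFrom h (s ∷ w)) → T (isDyckFrom (step h s) w)
isDyckFrom-tail h       U w   = subst T (isDyckFrom-U h w)
isDyckFrom-tail (suc h) D w p = p

isDyckFrom-balance : ∀ h w → T (isDyckFrom h w) → h + length w ≡ 2 * downs w
isDyckFrom-balance zero    []      _ = refl
isDyckFrom-balance h       (U ∷ w) p = begin
  h + suc (length w) ≡⟨ +-suc h (length w) ⟩
  suc h + length w   ≡⟨ isDyckFrom-balance (suc h) w (isDyckFrom-tail h U w p) ⟩
  2 * downs w        ∎
  where open ≡-Reasoning
isDyckFrom-balance (suc h) (D ∷ w) p = begin
  suc h + suc (length w) ≡⟨ cong suc (+-suc h (length w)) ⟩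
  2 + (h + length w)     ≡⟨ cong (2 +_) (isDyckFrom-balance h w p) ⟩
  2 + 2 * downs w        ≡⟨ *-distribˡ-+ 2 1 (downs w) ⟨
  2 * (1 + downs w)      ∎
  where open ≡-Reasoning

height≤⇔downs≤ : ∀ {hp hq P Q} → T (isDyckFrom hp P) → T (isDyckFrom hq Q) →
                 length P ≡ length Q → hp ≤ hq ⇔ downs P ≤ downs Q
height≤⇔downs≤ {hp} {hq} {P} {Q} dP dQ eq = mk⇔
  (λ le → *-cancelˡ-≤ 2 (subst₂ _≤_ balance-P balance-Q (+-monoˡ-≤ (length P) le)))
  (λ le → +-cancelʳ-≤ (length P) hp hq (subst₂ _≤_ (sym balance-P) (sym balance-Q) (*-monoʳ-≤ 2 le)))
  where
  balance-P : hp + length P ≡ 2 * downs P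
  balance-P = isDyckFrom-balance hp P dP
  balance-Q : hq + length P ≡ 2 * downs Q
  balance-Q = trans (cong (hq +_) eq) (isDyckFrom-balance hq Q dQ)

below⇔suffix-downs≤ : ∀ hp hq P Q → T (isDyckFrom hp P) → T (isDyckFrom hq Q) →
                      length P ≡ length Q →
                      (hp ≤ hq × T (belowFrom hp hq P Q)) ⇔ (∀ j → downs (drop j P) ≤ downs (drop j Q))
below⇔suffix-downs≤ zero    zero    []      []      _  _  _  =
  mk⇔ (λ { _ zero → z≤n ; _ (suc j) → z≤n }) (λ _ → z≤n , _)
below⇔suffix-downs≤ (suc _) _       []      []      () _  _
below⇔suffix-downs≤ zero    (suc _) []      []      _  () _
below⇔suffix-downs≤ hp      hq      (p ∷ P) (q ∷ Q) dP dQ eq = begin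
  (hp ≤ hq × T ((hp′ ≤ᵇ hq′) ∧ belowFrom hp′ hq′ P Q))
    ≈⟨ height≤⇔downs≤ dP dQ eq ×-⇔ ⇔-trans T-∧ (T-≤ᵇ ×-⇔ ⇔-refl) ⟩
  (downs (p ∷ P) ≤ downs (q ∷ Q) × (hp′ ≤ hq′ × T (belowFrom hp′ hq′ P Q)))
    ≈⟨ ⇔-refl ×-⇔ below⇔suffix-downs≤ hp′ hq′ P Q
                    (isDyckFrom-tail hp p P dP) (isDyckFrom-tail hq q Q dQ) (suc-injective eq) ⟩
  (downs (p ∷ P) ≤ downs (q ∷ Q) × (∀ j → downs (drop j P) ≤ downs (drop j Q)))
    ≈⟨ ∀-split ⟨
  (∀ j → downs (drop j (p ∷ P)) ≤ downs (drop j (q ∷ Q))) ∎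
  where
  open ⇔-Reasoning
  hp′ hq′ : ℕ
  hp′ = step hp p
  hq′ = step hq q

≤S⇔prefix-downs≥ : ∀ P Q → T (isDyck P) → T (isDyck Q) → length P ≡ length Q →
                   T (P ≤S Q) ⇔ (∀ j → downs (take j Q) ≤ downs (take j P))
≤S⇔prefix-downs≥ P Q dP dQ eq = begin
  T (P ≤S Q)                                  ≈⟨ mk⇔ (z≤n ,_) proj₂ ⟩
  (0 ≤ 0 × T (P ≤S Q))                        ≈⟨ below⇔suffix-downs≤ 0 0 P Q dP dQ eq ⟩
  (∀ j → downs (drop j P) ≤ downs (drop j Q)) ≈⟨ ∀-cong complement ⟩
  (∀ j → downs (take j Q) ≤ downs (take j P)) ∎
  where
  open ⇔-Reasoning
  same-downs : downs P ≡ downs Q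
  same-downs = *-cancelˡ-≡ (downs P) (downs Q) 2
    (trans (sym (isDyckFrom-balance 0 P dP)) (trans (cong (0 +_) eq) (isDyckFrom-balance 0 Q dQ)))
  complement : ∀ j → downs (drop j P) ≤ downs (drop j Q) ⇔ downs (take j Q) ≤ downs (take j P)
  complement j = ≤-complement
    (trans (count-take+drop isDown j P) (trans same-downs (sym (count-take+drop isDown j Q))))

-- Positions of the down steps

fromAscents : List ℕ → List Step
fromAscents []       = []
fromAscents (g ∷ gs) = replicate g U ++ D ∷ fromAscents gs

-- For k < length gs, the 1-based position of the (k+1)-th D in fromAscents gs.
downPosition : List ℕ → ℕ → ℕ
downPosition []       _       = 0
downPosition (g ∷ gs) zero    = suc g
downPosition (g ∷ gs) (suc k) = suc g + downPosition gs k

DownPositions≤ : List ℕ → List ℕ → Set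
DownPositions≤ gs hs = ∀ k → k < length gs → downPosition gs k ≤ downPosition hs k

downs-fromAscents : ∀ gs → downs (fromAscents gs) ≡ length gs
downs-fromAscents []           = refl
downs-fromAscents (zero  ∷ gs) = cong suc (downs-fromAscents gs)
downs-fromAscents (suc g ∷ gs) = downs-fromAscents (g ∷ gs)

prefix-downs⇔downPosition : ∀ gs k j → k < length gs →
                            suc k ≤ downs (take j (fromAscents gs)) ⇔ downPosition gs k ≤ j
prefix-downs⇔downPosition (zero  ∷ gs) zero    zero    _  = mk⇔ (λ ()) (λ ())
prefix-downs⇔downPosition (zero  ∷ gs) (suc k) zero    _  = mk⇔ (λ ()) (λ ())
prefix-downs⇔downPosition (zero  ∷ gs) zero    (suc j) _  = mk⇔ (λ _ → s≤s z≤n) (λ _ → s≤s z≤n)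
prefix-downs⇔downPosition (zero  ∷ gs) (suc k) (suc j) lt =
  ⇔-trans suc≤suc⇔ (⇔-trans (prefix-downs⇔downPosition gs k j (s≤s⁻¹ lt)) (⇔-sym suc≤suc⇔))
prefix-downs⇔downPosition (suc g ∷ gs) zero    zero    _  = mk⇔ (λ ()) (λ ())
prefix-downs⇔downPosition (suc g ∷ gs) (suc k) zero    _  = mk⇔ (λ ()) (λ ())
prefix-downs⇔downPosition (suc g ∷ gs) zero    (suc j) lt =
  ⇔-trans (prefix-downs⇔downPosition (g ∷ gs) zero j lt) (⇔-sym suc≤suc⇔)
prefix-downs⇔downPosition (suc g ∷ gs) (suc k) (suc j) lt =
  ⇔-trans (prefix-downs⇔downPosition (g ∷ gs) (suc k) j lt) (⇔-sym suc≤suc⇔)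

prefix-downs≥⇔DownPositions≤ : ∀ gs hs → length gs ≡ length hs →
  (∀ j → downs (take j (fromAscents hs)) ≤ downs (take j (fromAscents gs))) ⇔ DownPositions≤ gs hs
prefix-downs≥⇔DownPositions≤ gs hs eq =
  counts≥⇔positions≤ (λ {k} {j} lt → prefix-downs⇔downPosition gs k j lt)
                     (λ {k} {j} lt → prefix-downs⇔downPosition hs k j (subst (k <_) eq lt))
                     prefix-downs≤length
  where
  prefix-downs≤length : ∀ j → downs (take j (fromAscents hs)) ≤ length gs
  prefix-downs≤length j = begin
    downs (take j (fromAscents hs))                                   ≤⟨ m≤m+n _ _ ⟩
    downs (take j (fromAscents hs)) + downs (drop j (fromAscents hs)) ≡⟨ count-take+drop isDown j _ ⟩
    downs (fromAscents hs)                                            ≡⟨ downs-fromAscents hs ⟩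
    length hs                                                         ≡⟨ eq ⟨
    length gs                                                         ∎
    where open ≤-Reasoning

-- Block decomposition of DUU-avoiding Dyck paths

data Block : Set where
  fall peak : Block

ascent : Block → ℕ
ascent fall = 0
ascent peak = 1

isFall : Block → ℕ
isFall fall = 1
isFall peak = 0

falls : List Block → ℕ
falls = count isFall

blockWord : List Block → List Step
blockWord bs = fromAscents (map ascent bs)

blockAscents : List Block → List ℕ
blockAscents bs = suc (falls bs) ∷ map ascent bs

fromBlocks : List Block → List Step
fromBlocks bs = fromAscents (blockAscents bs)

readBlocks : List Step → List Block
readBlocks (D ∷ w)     = fall ∷ readBlocks w
readBlocks (U ∷ D ∷ w) = peak ∷ readBlocks w
readBlocks _           = []

toBlocks : List Step → List Block
toBlocks []      = []
toBlocks (U ∷ w) = toBlocks w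
toBlocks (D ∷ w) = readBlocks w

inF∞ : ℕ → List Step → Bool
inF∞ n w = isDyck w ∧ avoidsDUU w ∧ (length w ≡ᵇ 2 * n)

module _ (n : ℕ) (w : List Step) (p : T (inF∞ n w)) where

  inF∞⇒isDyck : T (isDyck w)
  inF∞⇒isDyck = to (T-∧ {isDyck w}) p .proj₁

  inF∞⇒avoidsDUU : T (avoidsDUU w)
  inF∞⇒avoidsDUU = to (T-∧ {avoidsDUU w}) (to (T-∧ {isDyck w}) p .proj₂) .proj₁

  inF∞⇒length : length w ≡ 2 * n
  inF∞⇒length = ≡ᵇ⇒≡ _ _ (to (T-∧ {avoidsDUU w}) (to (T-∧ {isDyck w}) p .proj₂) .proj₂)

isDyckFrom-ascent : ∀ k h w → isDyckFrom h (replicate k U ++ w) ≡ isDyckFrom (k + h) w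
isDyckFrom-ascent zero    h w = refl
isDyckFrom-ascent (suc k) h w =
  trans (isDyckFrom-U h _)
        (trans (isDyckFrom-ascent k (suc h) w) (cong (λ h′ → isDyckFrom h′ w) (+-suc k h)))

isDyckFrom-blockWord : ∀ bs → T (isDyckFrom (falls bs) (blockWord bs))
isDyckFrom-blockWord []          = _
isDyckFrom-blockWord (fall ∷ bs) = isDyckFrom-blockWord bs
isDyckFrom-blockWord (peak ∷ bs) = subst T (sym (isDyckFrom-U (falls bs) _)) (isDyckFrom-blockWord bs)

isDyck-fromBlocks : ∀ bs → T (isDyck (fromBlocks bs))
isDyck-fromBlocks bs = subst T (sym (trans (isDyckFrom-ascent (suc (falls bs)) 0 _) start-height))
                             (isDyckFrom-blockWord bs)
  where
  start-height : isDyckFrom (suc (falls bs) + 0) (D ∷ blockWord bs) ≡ isDyckFrom (falls bs) (blockWord bs)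
  start-height = cong (λ h → isDyckFrom h (D ∷ blockWord bs)) (+-identityʳ (suc (falls bs)))

avoidsDUU-ascent : ∀ k w → avoidsDUU (replicate k U ++ w) ≡ avoidsDUU w
avoidsDUU-ascent zero    w = refl
avoidsDUU-ascent (suc k) w = avoidsDUU-ascent k w

avoidsDUU-blockWord : ∀ bs → T (avoidsDUU (D ∷ blockWord bs))
avoidsDUU-blockWord []          = _
avoidsDUU-blockWord (fall ∷ bs) = avoidsDUU-blockWord bs
avoidsDUU-blockWord (peak ∷ bs) = avoidsDUU-blockWord bs

avoidsDUU-fromBlocks : ∀ bs → T (avoidsDUU (fromBlocks bs))
avoidsDUU-fromBlocks bs = subst T (sym (avoidsDUU-ascent (suc (falls bs)) _)) (avoidsDUU-blockWord bs)

length-blockWord : ∀ bs → length (blockWord bs) + falls bs ≡ 2 * length bs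
length-blockWord []          = refl
length-blockWord (fall ∷ bs) =
  trans (cong suc (+-suc _ (falls bs)))
        (trans (cong (2 +_) (length-blockWord bs)) (sym (*-suc 2 (length bs))))
length-blockWord (peak ∷ bs) = trans (cong (2 +_) (length-blockWord bs)) (sym (*-suc 2 (length bs)))

length-fromBlocks : ∀ bs → length (fromBlocks bs) ≡ 2 * suc (length bs)
length-fromBlocks bs = begin
  length (replicate (suc (falls bs)) U ++ D ∷ blockWord bs)
    ≡⟨ length-++ (replicate (suc (falls bs)) U) ⟩
  length (replicate (suc (falls bs)) U) + suc (length (blockWord bs))
    ≡⟨ cong (_+ suc (length (blockWord bs))) (length-replicate (suc (falls bs))) ⟩
  suc (falls bs) + suc (length (blockWord bs))
    ≡⟨ cong suc (trans (+-suc (falls bs) _) (cong suc (+-comm (falls bs) _))) ⟩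
  2 + (length (blockWord bs) + falls bs)
    ≡⟨ cong (2 +_) (length-blockWord bs) ⟩
  2 + 2 * length bs
    ≡⟨ *-suc 2 (length bs) ⟨
  2 * suc (length bs) ∎
  where open ≡-Reasoning

fromBlocks-inF∞ : ∀ m bs → length bs ≡ m → T (inF∞ (suc m) (fromBlocks bs))
fromBlocks-inF∞ _ bs refl =
  from T-∧ ( isDyck-fromBlocks bs
           , from T-∧ (avoidsDUU-fromBlocks bs , ≡⇒≡ᵇ _ _ (length-fromBlocks bs)) )

toBlocks-ascent : ∀ k w → toBlocks (replicate k U ++ D ∷ w) ≡ readBlocks w
toBlocks-ascent zero    w = refl
toBlocks-ascent (suc k) w = toBlocks-ascent k w

readBlocks-blockWord : ∀ bs → readBlocks (blockWord bs) ≡ bs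
readBlocks-blockWord []          = refl
readBlocks-blockWord (fall ∷ bs) = cong (fall ∷_) (readBlocks-blockWord bs)
readBlocks-blockWord (peak ∷ bs) = cong (peak ∷_) (readBlocks-blockWord bs)

toBlocks-fromBlocks : ∀ bs → toBlocks (fromBlocks bs) ≡ bs
toBlocks-fromBlocks bs = trans (toBlocks-ascent (suc (falls bs)) _) (readBlocks-blockWord bs)

blockWord-readBlocks : ∀ h w → T (isDyckFrom h w) → T (avoidsDUU (D ∷ w)) →
                       blockWord (readBlocks w) ≡ w × falls (readBlocks w) ≡ h
blockWord-readBlocks zero    []          _ _ = refl , refl
blockWord-readBlocks (suc h) (D ∷ w)     p q =
  let (word≡ , falls≡) = blockWord-readBlocks h w p q
  in cong (D ∷_) word≡ , cong suc falls≡
blockWord-readBlocks h       (U ∷ D ∷ w) p q =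
  let (word≡ , falls≡) = blockWord-readBlocks h w (isDyckFrom-tail h U (D ∷ w) p) q
  in cong (λ v → U ∷ D ∷ v) word≡ , falls≡
blockWord-readBlocks zero    (U ∷ [])    () _
blockWord-readBlocks (suc h) (U ∷ [])    () _

ascent-decomposition : ∀ k w → T (isDyckFrom (suc k) w) → T (avoidsDUU w) →
                       Σ ℕ λ j → k + j ≡ falls (toBlocks w)
                               × w ≡ replicate j U ++ D ∷ blockWord (toBlocks w)
ascent-decomposition k (U ∷ w) p q =
  let (j , falls≡ , word≡) = ascent-decomposition (suc k) w p q
  in suc j , trans (+-suc k j) falls≡ , cong (U ∷_) word≡
ascent-decomposition k (D ∷ w) p q =
  let (word≡ , falls≡) = blockWord-readBlocks k w p q
  in 0 , trans (+-identityʳ k) (sym falls≡) , cong (D ∷_) (sym word≡)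

fromBlocks-toBlocks : ∀ m P → T (inF∞ (suc m) P) → fromBlocks (toBlocks P) ≡ P
fromBlocks-toBlocks m (U ∷ w) p
  with ascent-decomposition 0 w (inF∞⇒isDyck (suc m) (U ∷ w) p) (inF∞⇒avoidsDUU (suc m) (U ∷ w) p)
... | _ , refl , word≡ = cong (U ∷_) (sym word≡)

length-toBlocks : ∀ m P → T (inF∞ (suc m) P) → length (toBlocks P) ≡ m
length-toBlocks m P p = suc-injective (*-cancelˡ-≡ _ _ 2 (begin
  2 * suc (length (toBlocks P))    ≡⟨ length-fromBlocks (toBlocks P) ⟨
  length (fromBlocks (toBlocks P)) ≡⟨ cong length (fromBlocks-toBlocks m P p) ⟩
  length P                         ≡⟨ inF∞⇒length (suc m) P p ⟩
  2 * suc m                        ∎))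
  where open ≡-Reasoning

SuffixFalls≤ : List Block → List Block → Set
SuffixFalls≤ xs ys = ∀ k → falls (drop k xs) ≤ falls (drop k ys)

downPosition-merge : ∀ g g′ gs k →
                     downPosition (g ∷ g′ ∷ gs) (suc k) ≡ downPosition (g + suc g′ ∷ gs) k
downPosition-merge g g′ gs zero    = refl
downPosition-merge g g′ gs (suc k) = sym (+-assoc (suc g) (suc g′) (downPosition gs k))

-- c accounts for the blocks already absorbed into the first ascent by downPosition-merge.
downPosition-blockAscents : ∀ c bs k → k ≤ length bs →
  downPosition (suc (c + falls bs) ∷ map ascent bs) k ≡ 2 * suc k + (c + falls (drop k bs))
downPosition-blockAscents c bs       zero    _        = refl
downPosition-blockAscents c (b ∷ bs) (suc k) (s≤s k≤) = begin
  downPosition (suc (c + falls (b ∷ bs)) ∷ ascent b ∷ map ascent bs) (suc k)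
    ≡⟨ downPosition-merge (suc (c + falls (b ∷ bs))) (ascent b) (map ascent bs) k ⟩
  downPosition (suc (c + falls (b ∷ bs)) + suc (ascent b) ∷ map ascent bs) k
    ≡⟨ cong (λ g → downPosition (g ∷ map ascent bs) k) (merged-ascent b) ⟩
  downPosition (suc (2 + c + falls bs) ∷ map ascent bs) k
    ≡⟨ downPosition-blockAscents (2 + c) bs k k≤ ⟩
  2 * suc k + (2 + c + falls (drop k bs))
    ≡⟨ shift k c (falls (drop k bs)) ⟩
  2 * suc (suc k) + (c + falls (drop k bs)) ∎
  where
  open ≡-Reasoning
  after-fall : ∀ c f → suc (c + suc f) + 1 ≡ suc (2 + c + f)
  after-fall = solve-∀
  after-peak : ∀ c f → suc (c + f) + 2 ≡ suc (2 + c + f)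
  after-peak = solve-∀
  merged-ascent : ∀ b → suc (c + falls (b ∷ bs)) + suc (ascent b) ≡ suc (2 + c + falls bs)
  merged-ascent fall = after-fall c (falls bs)
  merged-ascent peak = after-peak c (falls bs)
  shift : ∀ k c f → 2 * suc k + (2 + c + f) ≡ 2 * suc (suc k) + (c + f)
  shift = solve-∀

DownPositions≤⇔SuffixFalls≤ : ∀ xs ys → length xs ≡ length ys →
                              DownPositions≤ (blockAscents xs) (blockAscents ys) ⇔ SuffixFalls≤ xs ys
DownPositions≤⇔SuffixFalls≤ xs ys eq = mk⇔ suffixFalls≤ downPositions≤
  where
  closed-form : ∀ bs k → k ≤ length bs → downPosition (blockAscents bs) k ≡ 2 * suc k + falls (drop k bs)
  closed-form = downPosition-blockAscents 0
  length-ascents : length (blockAscents xs) ≡ suc (length xs)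
  length-ascents = cong suc (length-map ascent xs)
  suffixFalls≤ : DownPositions≤ (blockAscents xs) (blockAscents ys) → SuffixFalls≤ xs ys
  suffixFalls≤ position≤ k with k ≤? length xs
  ... | yes k≤ = +-cancelˡ-≤ (2 * suc k) _ _
        (subst₂ _≤_ (closed-form xs k k≤) (closed-form ys k (subst (k ≤_) eq k≤))
          (position≤ k (subst (k <_) (sym length-ascents) (s≤s k≤))))
  ... | no k≰ = subst (_≤ falls (drop k ys)) (cong falls (sym (drop-all k xs (≰⇒≥ k≰)))) z≤n
  downPositions≤ : SuffixFalls≤ xs ys → DownPositions≤ (blockAscents xs) (blockAscents ys)
  downPositions≤ suffix≤ k k< =
    subst₂ _≤_ (sym (closed-form xs k k≤)) (sym (closed-form ys k (subst (k ≤_) eq k≤)))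
      (+-monoʳ-≤ (2 * suc k) (suffix≤ k))
    where
    k≤ : k ≤ length xs
    k≤ = s≤s⁻¹ (subst (k <_) length-ascents k<)

fromBlocks≤S⇔SuffixFalls≤ : ∀ xs ys → length xs ≡ length ys →
                            T (fromBlocks xs ≤S fromBlocks ys) ⇔ SuffixFalls≤ xs ys
fromBlocks≤S⇔SuffixFalls≤ xs ys eq = begin
  T (fromBlocks xs ≤S fromBlocks ys)
    ≈⟨ ≤S⇔prefix-downs≥ (fromBlocks xs) (fromBlocks ys) (isDyck-fromBlocks xs) (isDyck-fromBlocks ys)
                         same-length ⟩
  (∀ j → downs (take j (fromBlocks ys)) ≤ downs (take j (fromBlocks xs)))
    ≈⟨ prefix-downs≥⇔DownPositions≤ (blockAscents xs) (blockAscents ys)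
         (cong suc (trans (length-map ascent xs) (trans eq (sym (length-map ascent ys))))) ⟩
  DownPositions≤ (blockAscents xs) (blockAscents ys)
    ≈⟨ DownPositions≤⇔SuffixFalls≤ xs ys eq ⟩
  SuffixFalls≤ xs ys ∎
  where
  open ⇔-Reasoning
  same-length : length (fromBlocks xs) ≡ length (fromBlocks ys)
  same-length =
    trans (length-fromBlocks xs) (trans (cong (λ l → 2 * suc l) eq) (sym (length-fromBlocks ys)))

-- Bicolored Motzkin paths

isRise : MStep → ℕ
isRise MU = 1
isRise _  = 0

isDescent : MStep → ℕ
isDescent MD = 1
isDescent _  = 0

rises descents : List MStep → ℕ
rises    = count isRise
descents = count isDescent

isMotzkinFrom-∷ʳ : ∀ h u s → T (isMotzkinFrom h (u ∷ʳ s)) ⇔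
                   (descents (u ∷ʳ s) ≤ h + rises (u ∷ʳ s) × T (isMotzkinFrom h u))
isMotzkinFrom-∷ʳ h       []       MU = mk⇔ (λ _ → z≤n , _) _
isMotzkinFrom-∷ʳ zero    []       MD = mk⇔ (λ ()) (λ { (() , _) })
isMotzkinFrom-∷ʳ (suc h) []       MD = mk⇔ (λ _ → s≤s z≤n , _) _
isMotzkinFrom-∷ʳ h       []       F₁ = mk⇔ (λ _ → z≤n , _) _
isMotzkinFrom-∷ʳ h       []       F₂ = mk⇔ (λ _ → z≤n , _) _
isMotzkinFrom-∷ʳ h       (MU ∷ u) s  = ⇔-trans (isMotzkinFrom-∷ʳ (suc h) u s)
  (mk⇔ (subst (descents (u ∷ʳ s) ≤_) (sym (+-suc h _))) (subst (descents (u ∷ʳ s) ≤_) (+-suc h _))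
   ×-⇔ ⇔-refl)
isMotzkinFrom-∷ʳ zero    (MD ∷ u) s  = mk⇔ (λ ()) (λ { (_ , ()) })
isMotzkinFrom-∷ʳ (suc h) (MD ∷ u) s  = ⇔-trans (isMotzkinFrom-∷ʳ h u s) (⇔-sym suc≤suc⇔ ×-⇔ ⇔-refl)
isMotzkinFrom-∷ʳ h       (F₁ ∷ u) s  = isMotzkinFrom-∷ʳ h u s
isMotzkinFrom-∷ʳ h       (F₂ ∷ u) s  = isMotzkinFrom-∷ʳ h u s

isMotzkinFrom-reverse : ∀ h w → T (isMotzkinFrom h (reverse w)) ⇔
                        (∀ k → descents (drop k w) ≤ h + rises (drop k w))
isMotzkinFrom-reverse h []      = mk⇔ (λ { _ zero → z≤n ; _ (suc k) → z≤n }) _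
isMotzkinFrom-reverse h (s ∷ w) = begin
  T (isMotzkinFrom h (reverse (s ∷ w)))
    ≡⟨ cong (λ v → T (isMotzkinFrom h v)) (unfold-reverse s w) ⟩
  T (isMotzkinFrom h (reverse w ∷ʳ s))
    ≈⟨ isMotzkinFrom-∷ʳ h (reverse w) s ⟩
  (descents (reverse w ∷ʳ s) ≤ h + rises (reverse w ∷ʳ s) × T (isMotzkinFrom h (reverse w)))
    ≡⟨ cong (λ v → descents v ≤ h + rises v × T (isMotzkinFrom h (reverse w))) (unfold-reverse s w) ⟨
  (descents (reverse (s ∷ w)) ≤ h + rises (reverse (s ∷ w)) × T (isMotzkinFrom h (reverse w)))
    ≡⟨ cong₂ (λ d r → d ≤ h + r × T (isMotzkinFrom h (reverse w)))
             (count-reverse isDescent (s ∷ w)) (count-reverse isRise (s ∷ w)) ⟩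
  (descents (s ∷ w) ≤ h + rises (s ∷ w) × T (isMotzkinFrom h (reverse w)))
    ≈⟨ ⇔-refl ×-⇔ isMotzkinFrom-reverse h w ⟩
  (descents (s ∷ w) ≤ h + rises (s ∷ w) × (∀ k → descents (drop k w) ≤ h + rises (drop k w)))
    ≈⟨ ∀-split ⟨
  (∀ k → descents (drop k (s ∷ w)) ≤ h + rises (drop k (s ∷ w))) ∎
  where open ⇔-Reasoning

pair : Block → Block → MStep
pair fall fall = F₁
pair peak peak = F₂
pair peak fall = MU
pair fall peak = MD

unpair : MStep → Block × Block
unpair F₁ = fall , fall
unpair F₂ = peak , peak
unpair MU = peak , fall
unpair MD = fall , peak

zipBlocks : List Block → List Block → List MStep
zipBlocks xs ys = reverse (zipWith pair xs ys)

unzipBlocks : List MStep → List Block × List Block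
unzipBlocks w = unzipWith unpair (reverse w)

unpair-pair : ∀ xy → unpair (pair (proj₁ xy) (proj₂ xy)) ≡ xy
unpair-pair (fall , fall) = refl
unpair-pair (fall , peak) = refl
unpair-pair (peak , fall) = refl
unpair-pair (peak , peak) = refl

pair-unpair : ∀ s → pair (proj₁ (unpair s)) (proj₂ (unpair s)) ≡ s
pair-unpair MU = refl
pair-unpair MD = refl
pair-unpair F₁ = refl
pair-unpair F₂ = refl

drop-zipWith : {A B C : Set} (f : A → B → C) (k : ℕ) (xs : List A) (ys : List B) →
               drop k (zipWith f xs ys) ≡ zipWith f (drop k xs) (drop k ys)
drop-zipWith f zero    xs       ys       = refl
drop-zipWith f (suc k) []       ys       = refl
drop-zipWith f (suc k) (x ∷ xs) []       = sym (zipWith-zeroʳ f (drop k xs))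
drop-zipWith f (suc k) (x ∷ xs) (y ∷ ys) = drop-zipWith f k xs ys

falls+descents : ∀ xs ys → length xs ≡ length ys →
                 falls ys + descents (zipWith pair xs ys) ≡ falls xs + rises (zipWith pair xs ys)
falls+descents []          []          _  = refl
falls+descents (fall ∷ xs) (fall ∷ ys) eq = cong suc (falls+descents xs ys (suc-injective eq))
falls+descents (peak ∷ xs) (peak ∷ ys) eq = falls+descents xs ys (suc-injective eq)
falls+descents (peak ∷ xs) (fall ∷ ys) eq =
  trans (cong suc (falls+descents xs ys (suc-injective eq))) (sym (+-suc _ _))
falls+descents (fall ∷ xs) (peak ∷ ys) eq =
  trans (+-suc _ _) (cong suc (falls+descents xs ys (suc-injective eq)))

isMotzkin⇔SuffixFalls≤ : ∀ xs ys → length xs ≡ length ys →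
                         T (isMotzkinFrom 0 (zipBlocks xs ys)) ⇔ SuffixFalls≤ xs ys
isMotzkin⇔SuffixFalls≤ xs ys eq = ⇔-trans (isMotzkinFrom-reverse 0 (zipWith pair xs ys)) (∀-cong suffix)
  where
  suffix : ∀ k → descents (drop k (zipWith pair xs ys)) ≤ rises (drop k (zipWith pair xs ys)) ⇔
                 falls (drop k xs) ≤ falls (drop k ys)
  suffix k rewrite drop-zipWith pair k xs ys = ≤-complement (falls+descents (drop k xs) (drop k ys)
    (trans (length-drop k xs) (trans (cong (_∸ k) eq) (sym (length-drop k ys)))))

fromBlocks≤S⇔isMotzkin : ∀ xs ys → length xs ≡ length ys →
                         T (fromBlocks xs ≤S fromBlocks ys) ⇔ T (isMotzkinFrom 0 (zipBlocks xs ys))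
fromBlocks≤S⇔isMotzkin xs ys eq =
  ⇔-trans (fromBlocks≤S⇔SuffixFalls≤ xs ys eq) (⇔-sym (isMotzkin⇔SuffixFalls≤ xs ys eq))

zipBlocks-unzipBlocks : ∀ w → zipBlocks (proj₁ (unzipBlocks w)) (proj₂ (unzipBlocks w)) ≡ w
zipBlocks-unzipBlocks w =
  trans (cong reverse (zipWith-unzipWith unpair pair pair-unpair (reverse w))) (reverse-involutive w)

unzipBlocks-zipBlocks : ∀ xs ys → length xs ≡ length ys → unzipBlocks (zipBlocks xs ys) ≡ (xs , ys)
unzipBlocks-zipBlocks xs ys eq =
  trans (cong (unzipWith unpair) (reverse-involutive _))
        (unzipWith-zipWith unpair pair unpair-pair xs ys eq)

length-zipBlocks : ∀ m xs ys → length xs ≡ m → length ys ≡ m → length (zipBlocks xs ys) ≡ m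
length-zipBlocks m xs ys length-xs length-ys = begin
  length (reverse (zipWith pair xs ys)) ≡⟨ length-reverse (zipWith pair xs ys) ⟩
  length (zipWith pair xs ys)           ≡⟨ length-zipWith pair xs ys ⟩
  length xs ⊓ length ys                 ≡⟨ cong₂ _⊓_ length-xs length-ys ⟩
  m ⊓ m                                 ≡⟨ ⊓-idem m ⟩
  m                                     ∎
  where open ≡-Reasoning

Interval-≡ : ∀ {n P P′ Q Q′ p p′ q q′ P≤Q P′≤Q′} → P ≡ P′ → Q ≡ Q′ →
             _≡_ {A = Interval n} (((P , p) , (Q , q)) , P≤Q) (((P′ , p′) , (Q′ , q′)) , P′≤Q′)
Interval-≡ {n} P≡P′ Q≡Q′ =
  ≡-subset {f = λ PQ → proj₁ (proj₁ PQ) ≤S proj₁ (proj₂ PQ)}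
    (cong₂ _,_ (≡-subset {f = inF∞ n} P≡P′) (≡-subset {f = inF∞ n} Q≡Q′))

module _ (m : ℕ) where

  toMotzkin : Interval (suc m) → BiMotzkin m
  toMotzkin (((P , p) , (Q , q)) , P≤Q) =
    zipBlocks xs ys ,
    from T-∧ ( to (fromBlocks≤S⇔isMotzkin xs ys (trans length-xs (sym length-ys))) blocks≤S
             , ≡⇒≡ᵇ _ _ (length-zipBlocks m xs ys length-xs length-ys) )
    where
    xs ys : List Block
    xs = toBlocks P
    ys = toBlocks Q
    length-xs : length xs ≡ m
    length-xs = length-toBlocks m P p
    length-ys : length ys ≡ m
    length-ys = length-toBlocks m Q q
    blocks≤S : T (fromBlocks xs ≤S fromBlocks ys)
    blocks≤S = subst₂ (λ P′ Q′ → T (P′ ≤S Q′))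
                      (sym (fromBlocks-toBlocks m P p)) (sym (fromBlocks-toBlocks m Q q)) P≤Q

  fromMotzkin : BiMotzkin m → Interval (suc m)
  fromMotzkin (w , v) =
    ((fromBlocks xs , fromBlocks-inF∞ m xs length-xs) ,
     (fromBlocks ys , fromBlocks-inF∞ m ys length-ys)) ,
    from (fromBlocks≤S⇔isMotzkin xs ys (trans length-xs (sym length-ys)))
         (subst (λ u → T (isMotzkinFrom 0 u)) (sym (zipBlocks-unzipBlocks w)) (to T-∧ v .proj₁))
    where
    xs ys : List Block
    xs = proj₁ (unzipBlocks w)
    ys = proj₂ (unzipBlocks w)
    length-w : length (reverse w) ≡ m
    length-w = trans (length-reverse w) (≡ᵇ⇒≡ _ _ (to T-∧ v .proj₂))
    length-xs : length xs ≡ m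
    length-xs = trans (length-unzipWith₁ unpair (reverse w)) length-w
    length-ys : length ys ≡ m
    length-ys = trans (length-unzipWith₂ unpair (reverse w)) length-w

  toMotzkin-fromMotzkin : ∀ y → toMotzkin (fromMotzkin y) ≡ y
  toMotzkin-fromMotzkin (w , v) = ≡-subset (trans
    (cong₂ zipBlocks (toBlocks-fromBlocks (proj₁ (unzipBlocks w)))
                     (toBlocks-fromBlocks (proj₂ (unzipBlocks w))))
    (zipBlocks-unzipBlocks w))

  fromMotzkin-toMotzkin : ∀ x → fromMotzkin (toMotzkin x) ≡ x
  fromMotzkin-toMotzkin (((P , p) , (Q , q)) , P≤Q) = Interval-≡ {suc m}
    (trans (cong (fromBlocks ∘ proj₁) unzipped) (fromBlocks-toBlocks m P p))
    (trans (cong (fromBlocks ∘ proj₂) unzipped) (fromBlocks-toBlocks m Q q))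
    where
    unzipped : unzipBlocks (zipBlocks (toBlocks P) (toBlocks Q)) ≡ (toBlocks P , toBlocks Q)
    unzipped = unzipBlocks-zipBlocks _ _ (trans (length-toBlocks m P p) (sym (length-toBlocks m Q q)))

  intervals↔biMotzkin : Interval (suc m) ↔ BiMotzkin m
  intervals↔biMotzkin = mk↔ₛ′ toMotzkin fromMotzkin toMotzkin-fromMotzkin fromMotzkin-toMotzkin

theorem4p4 : (n : ℕ) → 1 ≤ n → Interval n ⤖ BiMotzkin (n ∸ 1)
theorem4p4 zero    ()
theorem4p4 (suc m) _ = ↔⇒⤖ (intervals↔biMotzkin m)
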